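{- Let $p>5$ be a prime such that either ($p\equiv1\pmod4$ and the multiplicative order of $3$ modulo $p$ is $p-1$) or ($p\equiv 3\pmod 4$ and the multiplicative order of $3$ modulo $p$ is $(p-1)/2$). Then there exists an integer $k$ with $1\le k\le p-3$ such that $u_k\equiv u_{k+1}\pmod p$; consequently $\iota(p)<p-1=\rho(p)$.
   Context: The Salajan sequence is $u_1,u_2,\ldots$ with $u_j=(3^j-5(-1)^j)/4$ for $j\ge1$. For a prime $p>3$ the sequence is purely periodic modulo $p$ and $\rho(p)$ denotes its period, the smallest $k\ge1$ with $u_n\equiv u_{n+k}\pmod p$ for all $n\ge1$. For a positive integer $N$, $\iota(N)$ is the largest integer $k$ such that $u_1,\ldots,u_k$ are pairwise incongruent modulo $N$. -}

module Defs where

open import Data.Nat using (ℕ; zero; suc; _≤_; _<_)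
open import Data.Integer using (ℤ; +_; -_; _-_; _*_; _/_; _^_)
open import Data.Integer.Divisibility using (_∣_)
open import Data.Product using (_×_)
open import Relation.Nullary using (¬_)

negOnePow : ℕ → ℤ
negOnePow zero = + 1
negOnePow (suc j) = - negOnePow j

-- Salajan sequence u_j = (3^j - 5(-1)^j)/4 (exact integer division; indices j ≥ 1 used)
u : ℕ → ℤ
u j = ((+ 3) ^ j - (+ 5) * negOnePow j) / (+ 4)

infix 4 _≡[_]_
_≡[_]_ : ℤ → ℕ → ℤ → Set
a ≡[ N ] b = (+ N) ∣ (a - b)

MultOrder : ℕ → ℕ → ℕ → Set
MultOrder N a k =
  (1 ≤ k) × ((+ a) ^ k ≡[ N ] (+ 1)) ×
  (∀ m → 1 ≤ m → m < k → ¬ ((+ a) ^ m ≡[ N ] (+ 1)))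

IsPeriod : ℕ → ℕ → Set
IsPeriod N k = ∀ n → 1 ≤ n → u n ≡[ N ] u (n Data.Nat.+ k)

Rho : ℕ → ℕ → Set
Rho N k = (1 ≤ k) × IsPeriod N k × (∀ m → 1 ≤ m → m < k → ¬ IsPeriod N m)

PairwiseIncong : ℕ → ℕ → Set
PairwiseIncong N k = ∀ i j → 1 ≤ i → i < j → j ≤ k → ¬ (u i ≡[ N ] u j)

Iota : ℕ → ℕ → Set
Iota N k = PairwiseIncong N k × (∀ m → PairwiseIncong N m → m ≤ k)

{-# OPTIONS --safe #-}
-- Since 4 (u (k+1) - u k) = 2 (-1)^k ((-3)^k + 5), we have u k ≡ u (k+1) (mod p) exactly when
-- (-3)^k ≡ -5. Either hypothesis makes -3 a primitive root modulo p, so -5 ≡ (-3)^k for some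
-- k < p - 1; k = 0 would give p ∣ 6, and k = p - 2 would give p ∣ 14, i.e. p = 7, where -3 has
-- order 3. For the period, 4 (u (n+m) - u n) = 3^n (3^m - 1) - 5 (-1)^n ((-1)^m - 1); if m is a
-- period, the cases n = 1, 2 give 3^m ≡ 1 and (-1)^m = 1, so (-3)^m ≡ 1 and m ≥ p - 1.
module Submission where

open import Defs
open import Data.Nat using (ℕ; _+_; _∸_; _≤_; _<_; _%_; _/_)
open import Data.Nat.Primality using (Prime)
open import Data.Product using (Σ; _×_)
open import Data.Sum using (_⊎_)
open import Relation.Binary.PropositionalEquality using (_≡_)

open import Data.Empty using (⊥)
open import Data.Fin.Base using (Fin; zero; suc; toℕ; fromℕ<; punchOut)
import Data.Fin.Base as Fin
import Data.Fin.Properties as Fin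
open import Data.Integer.Base as ℤ using (ℤ; +_; -_; _-_; _*_; _^_; 0ℤ; 1ℤ; -1ℤ)
import Data.Integer.DivMod as ℤ
import Data.Integer.Properties as ℤ
open import Data.Integer.Divisibility.Signed
  using ( _∣_; divides; ∣ᵤ⇒∣; ∣⇒∣ᵤ; ∣-refl; ∣-trans
        ; ∣m∣n⇒∣m+n; ∣m+n∣m⇒∣n; ∣m∣n⇒∣m-n; ∣m⇒∣-m; ∣m⇒∣m*n; ∣n⇒∣m*n )
open import Data.Integer.Tactic.RingSolver using (solve-∀)
open import Data.Nat as ℕ using (zero; suc; z≤n; s≤s; z<s; s<s; NonZero)
import Data.Nat.DivMod as ℕ
import Data.Nat.Divisibility as ℕ
open import Data.Nat.Primality using (euclidsLemma; prime⇒nonTrivial; prime⇒irreducible; prime?; composite)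
import Data.Nat.Properties as ℕ
import Data.Nat.Tactic.RingSolver as ℕ-Solver
open import Data.Product using (_,_; proj₁; proj₂; ∃-syntax)
open import Data.Sum using (inj₁; inj₂; [_,_]′)
open import Function.Base using (_∘_; id)
open import Relation.Binary.Definitions using (tri<; tri≈; tri>)
open import Relation.Binary.PropositionalEquality using (refl; sym; trans; cong; cong₂; subst; _≢_; module ≡-Reasoning)
open import Relation.Nullary using (¬_; contradiction; yes; no)
open import Relation.Nullary.Decidable using (from-yes)

∣m-n⇒∣n-m : ∀ {d} m n → d ∣ m - n → d ∣ n - m
∣m-n⇒∣n-m m n d∣m-n = subst (_ ∣_) (negate m n) (∣m⇒∣-m d∣m-n)
  where
  negate : ∀ m n → - (m - n) ≡ n - m
  negate = solve-∀

^-distribʳ-* : ∀ a b n → (a * b) ^ n ≡ a ^ n * b ^ n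
^-distribʳ-* a b zero = refl
^-distribʳ-* a b (suc n) = trans (cong (a * b *_) (^-distribʳ-* a b n)) (interchange a b (a ^ n) (b ^ n))
  where
  interchange : ∀ w x y z → w * x * (y * z) ≡ w * y * (x * z)
  interchange = solve-∀

x-y∣x^n-y^n : ∀ x y n → x - y ∣ x ^ n - y ^ n
x-y∣x^n-y^n x y zero = divides 0ℤ refl
x-y∣x^n-y^n x y (suc n) = subst (x - y ∣_) (sym (split x y (x ^ n) (y ^ n)))
  (∣m∣n⇒∣m+n (∣n⇒∣m*n x (x-y∣x^n-y^n x y n)) (∣m⇒∣m*n (y ^ n) ∣-refl))
  where
  split : ∀ x y X Y → x * X - y * Y ≡ x * (X - Y) ℤ.+ (x - y) * Y
  split = solve-∀

∣x-y⇒∣x^n-y^n : ∀ {N} x y n → + N ∣ x - y → + N ∣ x ^ n - y ^ n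
∣x-y⇒∣x^n-y^n x y n N∣x-y = ∣-trans N∣x-y (x-y∣x^n-y^n x y n)

-1^-even : ∀ n → -1ℤ ^ (2 ℕ.* n) ≡ 1ℤ
-1^-even n = trans (sym (ℤ.^-*-assoc -1ℤ 2 n)) (ℤ.^-zeroˡ n)

-1^-odd : ∀ n → -1ℤ ^ suc (2 ℕ.* n) ≡ -1ℤ
-1^-odd n = cong (-1ℤ *_) (-1^-even n)

-1^-cases : ∀ n → -1ℤ ^ n ≡ 1ℤ ⊎ -1ℤ ^ n ≡ -1ℤ
-1^-cases zero = inj₁ refl
-1^-cases (suc n) with -1^-cases n
... | inj₁ eq = inj₂ (cong (-1ℤ *_) eq)
... | inj₂ eq = inj₁ (cong (-1ℤ *_) eq)

-1^n*-1^n≡1 : ∀ n → -1ℤ ^ n * -1ℤ ^ n ≡ 1ℤ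
-1^n*-1^n≡1 n = trans (sym (^-distribʳ-* -1ℤ -1ℤ n)) (ℤ.^-zeroˡ n)

negOnePow≡-1^ : ∀ n → negOnePow n ≡ -1ℤ ^ n
negOnePow≡-1^ zero = refl
negOnePow≡-1^ (suc n) = trans (cong -_ (negOnePow≡-1^ n)) (sym (ℤ.-1*i≡-i _))

-3^≡-1^*3^ : ∀ n → (- + 3) ^ n ≡ -1ℤ ^ n * (+ 3) ^ n
-3^≡-1^*3^ = ^-distribʳ-* -1ℤ (+ 3)

-3^≡3^ : ∀ n → -1ℤ ^ n ≡ 1ℤ → (- + 3) ^ n ≡ (+ 3) ^ n
-3^≡3^ n -1^n≡1 = trans (-3^≡-1^*3^ n) (trans (cong (_* (+ 3) ^ n) -1^n≡1) (ℤ.*-identityˡ _))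

-3^≡1⇒ : ∀ {N} m → + N ∣ (- + 3) ^ m - 1ℤ →
         -1ℤ ^ m ≡ 1ℤ × + N ∣ (+ 3) ^ m - 1ℤ ⊎ -1ℤ ^ m ≡ -1ℤ × + N ∣ (+ 3) ^ m ℤ.+ 1ℤ
-3^≡1⇒ {N} m N∣-3^m-1 with -1^-cases m
... | inj₁ -1^m≡1  = inj₁ (-1^m≡1 , subst (λ x → + N ∣ x - 1ℤ) (-3^≡3^ m -1^m≡1) N∣-3^m-1)
... | inj₂ -1^m≡-1 = inj₂ (-1^m≡-1 , subst (+ N ∣_) (negate ((+ 3) ^ m)) (∣m⇒∣-m N∣-3^m-1′))
  where
  negate : ∀ T → - (-1ℤ * T - 1ℤ) ≡ T ℤ.+ 1ℤ
  negate = solve-∀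
  N∣-3^m-1′ : + N ∣ -1ℤ * (+ 3) ^ m - 1ℤ
  N∣-3^m-1′ = subst (λ s → + N ∣ s * (+ 3) ^ m - 1ℤ) -1^m≡-1
                (subst (λ x → + N ∣ x - 1ℤ) (-3^≡-1^*3^ m) N∣-3^m-1)

∣∧<⇒≡0 : ∀ {m n} → m ℕ.∣ n → n < m → n ≡ 0
∣∧<⇒≡0 {n = zero}  _   _   = refl
∣∧<⇒≡0 {n = suc n} m∣n n<m = contradiction m∣n (ℕ.>⇒∤ n<m)

a/n*n≡a : ∀ a n .{{_ : ℤ.NonZero n}} → n ∣ a → a ℤ./ n * n ≡ a
a/n*n≡a a n n∣a = begin
  a ℤ./ n * n                        ≡⟨ ℤ.+-identityˡ _ ⟨
  + 0 ℤ.+ a ℤ./ n * n                ≡⟨ cong (λ r → + r ℤ.+ a ℤ./ n * n) remainder≡0 ⟨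
  + (a ℤ.% n) ℤ.+ a ℤ./ n * n        ≡⟨ ℤ.a≡a%n+[a/n]*n a n ⟨
  a                                  ∎
  where
  open ≡-Reasoning
  cancel : ∀ r x → r ℤ.+ x - x ≡ r
  cancel = solve-∀
  n∣remainder : n ∣ + (a ℤ.% n)
  n∣remainder = subst (n ∣_)
    (trans (cong (_- a ℤ./ n * n) (ℤ.a≡a%n+[a/n]*n a n)) (cancel (+ (a ℤ.% n)) (a ℤ./ n * n)))
    (∣m∣n⇒∣m-n n∣a (∣n⇒∣m*n (a ℤ./ n) ∣-refl))
  remainder≡0 : a ℤ.% n ≡ 0
  remainder≡0 = ∣∧<⇒≡0 (∣⇒∣ᵤ n∣remainder) (ℤ.n%d<d a n)

4∣3^j-5*-1^j : ∀ j → + 4 ∣ (+ 3) ^ j - + 5 * -1ℤ ^ j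
4∣3^j-5*-1^j j = subst (+ 4 ∣_) (regroup ((+ 3) ^ j) (-1ℤ ^ j))
  (∣m∣n⇒∣m-n (x-y∣x^n-y^n (+ 3) -1ℤ j) (∣n⇒∣m*n (-1ℤ ^ j) ∣-refl))
  where
  regroup : ∀ T S → T - S - S * + 4 ≡ T - + 5 * S
  regroup = solve-∀

u*4≡ : ∀ j → u j * + 4 ≡ (+ 3) ^ j - + 5 * -1ℤ ^ j
u*4≡ j = begin
  u j * + 4
    ≡⟨ cong (λ s → ((+ 3) ^ j - + 5 * s) ℤ./ + 4 * + 4) (negOnePow≡-1^ j) ⟩
  ((+ 3) ^ j - + 5 * -1ℤ ^ j) ℤ./ + 4 * + 4
    ≡⟨ a/n*n≡a _ (+ 4) (4∣3^j-5*-1^j j) ⟩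
  (+ 3) ^ j - + 5 * -1ℤ ^ j
    ∎
  where open ≡-Reasoning

u-shift : ∀ n k → (u (n + k) - u n) * + 4 ≡
                  (+ 3) ^ n * ((+ 3) ^ k - 1ℤ) - + 5 * -1ℤ ^ n * (-1ℤ ^ k - 1ℤ)
u-shift n k = begin
  (u (n + k) - u n) * + 4
    ≡⟨ distrib (u (n + k)) (u n) ⟩
  u (n + k) * + 4 - u n * + 4
    ≡⟨ cong₂ _-_ (u*4≡ (n + k)) (u*4≡ n) ⟩
  ((+ 3) ^ (n + k) - + 5 * -1ℤ ^ (n + k)) - ((+ 3) ^ n - + 5 * -1ℤ ^ n)
    ≡⟨ cong₂ (λ T S → (T - + 5 * S) - ((+ 3) ^ n - + 5 * -1ℤ ^ n))
             (ℤ.^-distribˡ-+-* (+ 3) n k) (ℤ.^-distribˡ-+-* -1ℤ n k) ⟩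
  ((+ 3) ^ n * (+ 3) ^ k - + 5 * (-1ℤ ^ n * -1ℤ ^ k)) - ((+ 3) ^ n - + 5 * -1ℤ ^ n)
    ≡⟨ regroup ((+ 3) ^ n) ((+ 3) ^ k) (-1ℤ ^ n) (-1ℤ ^ k) ⟩
  (+ 3) ^ n * ((+ 3) ^ k - 1ℤ) - + 5 * -1ℤ ^ n * (-1ℤ ^ k - 1ℤ)
    ∎
  where
  open ≡-Reasoning
  distrib : ∀ a b → (a - b) * + 4 ≡ a * + 4 - b * + 4
  distrib = solve-∀
  regroup : ∀ T T′ S S′ →
            (T * T′ - + 5 * (S * S′)) - (T - + 5 * S) ≡ T * (T′ - 1ℤ) - + 5 * S * (S′ - 1ℤ)
  regroup = solve-∀

u-step : ∀ n → (u (n + 1) - u n) * + 4 ≡ + 2 * -1ℤ ^ n * ((- + 3) ^ n ℤ.+ + 5)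
u-step n = begin
  (u (n + 1) - u n) * + 4
    ≡⟨ u-shift n 1 ⟩
  (+ 3) ^ n * (+ 3 - 1ℤ) - + 5 * -1ℤ ^ n * (-1ℤ - 1ℤ)
    ≡⟨ regroup ((+ 3) ^ n) (-1ℤ ^ n) ⟩
  + 2 * 1ℤ * (+ 3) ^ n ℤ.+ + 10 * -1ℤ ^ n
    ≡⟨ cong (λ s → + 2 * s * (+ 3) ^ n ℤ.+ + 10 * -1ℤ ^ n) (-1^n*-1^n≡1 n) ⟨
  + 2 * (-1ℤ ^ n * -1ℤ ^ n) * (+ 3) ^ n ℤ.+ + 10 * -1ℤ ^ n
    ≡⟨ factor ((+ 3) ^ n) (-1ℤ ^ n) ⟩
  + 2 * -1ℤ ^ n * (-1ℤ ^ n * (+ 3) ^ n ℤ.+ + 5)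
    ≡⟨ cong (λ x → + 2 * -1ℤ ^ n * (x ℤ.+ + 5)) (-3^≡-1^*3^ n) ⟨
  + 2 * -1ℤ ^ n * ((- + 3) ^ n ℤ.+ + 5)
    ∎
  where
  open ≡-Reasoning
  regroup : ∀ T S → T * (+ 3 - 1ℤ) - + 5 * S * (-1ℤ - 1ℤ) ≡ + 2 * 1ℤ * T ℤ.+ + 10 * S
  regroup = solve-∀
  factor : ∀ T S → + 2 * (S * S) * T ℤ.+ + 10 * S ≡ + 2 * S * (S * T ℤ.+ + 5)
  factor = solve-∀

≡⇒∣[Δu]*4 : ∀ {N} n k → u n ≡[ N ] u (n + k) → + N ∣ (u (n + k) - u n) * + 4
≡⇒∣[Δu]*4 {N} n k u[n]≡u[n+k] =
  ∣m⇒∣m*n (+ 4) (∣m-n⇒∣n-m (u n) (u (n + k)) (∣ᵤ⇒∣ u[n]≡u[n+k]))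

ι≤ : ∀ {N k i} → 1 ≤ k → u k ≡[ N ] u (k + 1) → Iota N i → i ≤ k
ι≤ {N} {k} {i} 1≤k u[k]≡u[k+1] (incongruent , _) with suc k ℕ.≤? i
... | yes k<i = contradiction (subst (λ j → u k ≡[ N ] u j) (ℕ.+-comm k 1) u[k]≡u[k+1])
                              (incongruent k (suc k) 1≤k (ℕ.n<1+n k) k<i)
... | no  k≮i = ℕ.≮⇒≥ k≮i

%≡0⇒∣ : ∀ a n .{{_ : ℤ.NonZero n}} → a ℤ.% n ≡ 0 → n ∣ a
%≡0⇒∣ a n a%n≡0 = divides (a ℤ./ n) (begin
  a                              ≡⟨ ℤ.a≡a%n+[a/n]*n a n ⟩
  + (a ℤ.% n) ℤ.+ a ℤ./ n * n    ≡⟨ cong (λ r → + r ℤ.+ a ℤ./ n * n) a%n≡0 ⟩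
  + 0 ℤ.+ a ℤ./ n * n            ≡⟨ ℤ.+-identityˡ _ ⟩
  a ℤ./ n * n                    ∎)
  where open ≡-Reasoning

%≡%⇒∣- : ∀ a b n .{{_ : ℤ.NonZero n}} → a ℤ.% n ≡ b ℤ.% n → n ∣ a - b
%≡%⇒∣- a b n a%n≡b%n = divides (a ℤ./ n - b ℤ./ n) (begin
  a - b
    ≡⟨ cong₂ _-_ (ℤ.a≡a%n+[a/n]*n a n) (ℤ.a≡a%n+[a/n]*n b n) ⟩
  (+ (a ℤ.% n) ℤ.+ a ℤ./ n * n) - (+ (b ℤ.% n) ℤ.+ b ℤ./ n * n)
    ≡⟨ cong (λ r → (+ r ℤ.+ a ℤ./ n * n) - (+ (b ℤ.% n) ℤ.+ b ℤ./ n * n)) a%n≡b%n ⟩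
  (+ (b ℤ.% n) ℤ.+ a ℤ./ n * n) - (+ (b ℤ.% n) ℤ.+ b ℤ./ n * n)
    ≡⟨ cancel (+ (b ℤ.% n)) (a ℤ./ n) (b ℤ./ n) n ⟩
  (a ℤ./ n - b ℤ./ n) * n
    ∎)
  where
  open ≡-Reasoning
  cancel : ∀ r q q′ n → (r ℤ.+ q * n) - (r ℤ.+ q′ * n) ≡ (q - q′) * n
  cancel = solve-∀

-- The n + 1 numbers x, f 0, …, f (n - 1) have nonzero residues modulo n + 1, so two of them collide.
residues-cover : ∀ {n} (f : Fin n → ℤ) →
                 (∀ i → ¬ + suc n ∣ f i) →
                 (∀ i j → + suc n ∣ f i - f j → i ≡ j) →
                 ∀ {x} → ¬ + suc n ∣ x → ∃[ i ] + suc n ∣ f i - x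
residues-cover {n} f f≢0 f-injective {x} x≢0 = from-collision (Fin.pigeonhole (ℕ.n<1+n n) slot)
  where
  value : Fin (suc n) → ℤ
  value zero    = x
  value (suc i) = f i

  residue : Fin (suc n) → Fin (suc n)
  residue i = fromℕ< (ℤ.n%d<d (value i) (+ suc n))

  residue≢0 : ∀ i → zero ≢ residue i
  residue≢0 i 0≡r =
    value≢0 i (%≡0⇒∣ (value i) (+ suc n) (trans (sym (Fin.toℕ-fromℕ< _)) (cong toℕ (sym 0≡r))))
    where
    value≢0 : ∀ i → ¬ + suc n ∣ value i
    value≢0 zero    = x≢0
    value≢0 (suc i) = f≢0 i

  slot : Fin (suc n) → Fin n
  slot i = punchOut (residue≢0 i)

  same-slot⇒∣- : ∀ i j → slot i ≡ slot j → + suc n ∣ value i - value j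
  same-slot⇒∣- i j same = %≡%⇒∣- (value i) (value j) (+ suc n)
    (trans (sym (Fin.toℕ-fromℕ< _))
      (trans (cong toℕ (Fin.punchOut-injective (residue≢0 i) (residue≢0 j) same)) (Fin.toℕ-fromℕ< _)))

  from-collision : ∃[ i ] ∃[ j ] i Fin.< j × slot i ≡ slot j → ∃[ i ] + suc n ∣ f i - x
  from-collision (_     , zero  , ()  , _)
  from-collision (zero  , suc j , _   , same) =
    j , ∣m-n⇒∣n-m x (f j) (same-slot⇒∣- zero (suc j) same)
  from-collision (suc i , suc j , i<j , same) =
    contradiction (f-injective i j (same-slot⇒∣- (suc i) (suc j) same)) (Fin.<⇒≢ (ℕ.s≤s⁻¹ i<j))

Order : ℕ → ℤ → ℕ → Set
Order N g k = 1 ≤ k × + N ∣ g ^ k - 1ℤ × (∀ m → 1 ≤ m → m < k → ¬ + N ∣ g ^ m - 1ℤ)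

multOrder⇒order : ∀ {N a k} → MultOrder N a k → Order N (+ a) k
multOrder⇒order (1≤k , a^k≡1 , minimal) =
  1≤k , ∣ᵤ⇒∣ a^k≡1 , λ m 1≤m m<k → minimal m 1≤m m<k ∘ ∣⇒∣ᵤ

order-unique-below-double : ∀ {N g k n} → Order N g k → + N ∣ g ^ n - 1ℤ → 1 ≤ n → n < 2 ℕ.* k → n ≡ k
order-unique-below-double {N} {g} {k} {n} (_ , g^k≡1 , minimal) g^n≡1 1≤n n<2k with ℕ.<-cmp n k
... | tri< n<k _ _ = contradiction g^n≡1 (minimal n 1≤n n<k)
... | tri≈ _ n≡k _ = n≡k
... | tri> _ _ k<n = contradiction g^d≡1 (minimal d (ℕ.m<n⇒0<n∸m k<n) d<k)
  where
  d : ℕ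
  d = n ∸ k
  d<k : d < k
  d<k = subst (d <_) (trans (ℕ.m+n∸m≡n k (k + 0)) (ℕ.+-identityʳ k)) (ℕ.∸-monoˡ-< n<2k (ℕ.<⇒≤ k<n))
  split : ∀ D K → D * K - 1ℤ ≡ D * (K - 1ℤ) ℤ.+ (D - 1ℤ)
  split = solve-∀
  g^d≡1 : + N ∣ g ^ d - 1ℤ
  g^d≡1 = ∣m+n∣m⇒∣n
    (subst (+ N ∣_) (trans (cong (λ e → g ^ e - 1ℤ) (sym (ℕ.m∸n+n≡m (ℕ.<⇒≤ k<n))))
                           (trans (cong (_- 1ℤ) (ℤ.^-distribˡ-+-* g d k)) (split (g ^ d) (g ^ k))))
           g^n≡1)
    (∣n⇒∣m*n (g ^ d) g^k≡1)

∤-small : ∀ {p n} .{{_ : NonZero n}} → n < p → ¬ + p ∣ + n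
∤-small n<p p∣n = ℕ.>⇒∤ n<p (∣⇒∣ᵤ p∣n)

module _ {p : ℕ} (p-prime : Prime p) where

  prime∣*⇒∣⊎∣ : ∀ a b → + p ∣ a * b → + p ∣ a ⊎ + p ∣ b
  prime∣*⇒∣⊎∣ a b p∣ab
    with euclidsLemma ℤ.∣ a ∣ ℤ.∣ b ∣ p-prime (subst (p ℕ.∣_) (ℤ.abs-* a b) (∣⇒∣ᵤ p∣ab))
  ... | inj₁ p∣a = inj₁ (∣ᵤ⇒∣ p∣a)
  ... | inj₂ p∣b = inj₂ (∣ᵤ⇒∣ p∣b)

  ∤*∤ : ∀ {a b} → ¬ + p ∣ a → ¬ + p ∣ b → ¬ + p ∣ a * b
  ∤*∤ p∤a p∤b = [ p∤a , p∤b ]′ ∘ prime∣*⇒∣⊎∣ _ _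

  ∤^ : ∀ {a} n → ¬ + p ∣ a → ¬ + p ∣ a ^ n
  ∤^ zero    p∤a = ∤-small (ℕ.nonTrivial⇒n>1 p {{prime⇒nonTrivial p-prime}})
  ∤^ (suc n) p∤a = ∤*∤ p∤a (∤^ n p∤a)

  ∣*-cancelˡ : ∀ {a b} → ¬ + p ∣ a → + p ∣ a * b → + p ∣ b
  ∣*-cancelˡ p∤a p∣ab = [ (λ p∣a → contradiction p∣a p∤a) , id ]′ (prime∣*⇒∣⊎∣ _ _ p∣ab)

  order⇒^-distinct : ∀ {g k a b} → Order p g k → ¬ + p ∣ g → a < b → b < k → ¬ + p ∣ g ^ a - g ^ b
  order⇒^-distinct {g} {k} {a} {b} (_ , _ , minimal) p∤g a<b b<k g^a≡g^b =
    minimal (b ∸ a) (ℕ.m<n⇒0<n∸m a<b) (ℕ.≤-<-trans (ℕ.m∸n≤m b a) b<k)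
      (∣*-cancelˡ (∤^ a p∤g) (subst (+ p ∣_) factor (∣m⇒∣-m g^a≡g^b)))
    where
    rearrange : ∀ A D → - (A - A * D) ≡ A * (D - 1ℤ)
    rearrange = solve-∀
    factor : - (g ^ a - g ^ b) ≡ g ^ a * (g ^ (b ∸ a) - 1ℤ)
    factor = trans (cong (λ e → - (g ^ a - g ^ e)) (sym (ℕ.m+[n∸m]≡n (ℕ.<⇒≤ a<b))))
                   (trans (cong (λ x → - (g ^ a - x)) (ℤ.^-distribˡ-+-* g a (b ∸ a)))
                          (rearrange (g ^ a) (g ^ (b ∸ a))))

  order⇒^-injective : ∀ {g k i j} → Order p g k → ¬ + p ∣ g → i < k → j < k →
                      + p ∣ g ^ i - g ^ j → i ≡ j
  order⇒^-injective {g} {k} {i} {j} order p∤g i<k j<k g^i≡g^j with ℕ.<-cmp i j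
  ... | tri< i<j _ _ = contradiction g^i≡g^j (order⇒^-distinct order p∤g i<j j<k)
  ... | tri≈ _ i≡j _ = i≡j
  ... | tri> _ _ j<i = contradiction (∣m-n⇒∣n-m (g ^ i) (g ^ j) g^i≡g^j) (order⇒^-distinct order p∤g j<i i<k)

order⇒^-surjective : ∀ {p g x} → Prime p → Order p g (p ∸ 1) → ¬ + p ∣ g → ¬ + p ∣ x →
                     ∃[ k ] k < p ∸ 1 × + p ∣ g ^ k - x
order⇒^-surjective {zero}  _       (() , _)
order⇒^-surjective {suc n} {g} p-prime order p∤g p∤x
  = let i , g^i≡x = residues-cover (λ i → g ^ toℕ i) (λ i → ∤^ p-prime (toℕ i) p∤g) injective p∤x
    in toℕ i , Fin.toℕ<n i , g^i≡x
  where
  injective : ∀ i j → + suc n ∣ g ^ toℕ i - g ^ toℕ j → i ≡ j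
  injective i j g^i≡g^j =
    Fin.toℕ-injective (order⇒^-injective p-prime order p∤g (Fin.toℕ<n i) (Fin.toℕ<n j) g^i≡g^j)

¬order[7,-3,6] : ¬ Order 7 (- + 3) 6
¬order[7,-3,6] (_ , _ , minimal) = minimal 3 (s≤s z≤n) (s<s (s<s (s<s z<s))) (divides (- + 4) refl)

prime>2⇒p∸1≡2*[p/2] : ∀ {p} → Prime p → 2 < p → p ∸ 1 ≡ 2 ℕ.* (p / 2)
prime>2⇒p∸1≡2*[p/2] {p} p-prime 2<p with p % 2 in p%2≡r | ℕ.m%n<n p 2
... | 0 | _ = contradiction (composite 2<p (ℕ.m%n≡0⇒n∣m p 2 p%2≡r)) (Prime.notComposite p-prime)
... | 1 | _ = trans (cong (_∸ 1) (trans (ℕ.m≡m%n+[m/n]*n p 2) (cong (_+ p / 2 ℕ.* 2) p%2≡r)))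
                    (ℕ.*-comm (p / 2) 2)
... | suc (suc _) | s<s (s<s ())

module _ {p : ℕ} (p-prime : Prime p) (5<p : 5 < p) where

  p∤2 : ¬ + p ∣ + 2
  p∤2 = ∤-small (ℕ.≤-<-trans (s≤s (s≤s z≤n)) 5<p)

  p∤3 : ¬ + p ∣ + 3
  p∤3 = ∤-small (ℕ.≤-<-trans (s≤s (s≤s (s≤s z≤n))) 5<p)

  p∤4 : ¬ + p ∣ + 4
  p∤4 = ∤-small (ℕ.≤-<-trans (s≤s (s≤s (s≤s (s≤s z≤n)))) 5<p)

  p∤5 : ¬ + p ∣ + 5
  p∤5 = ∤-small 5<p

  ≡1∧≡-1⇒⊥ : ∀ x → + p ∣ x - 1ℤ → + p ∣ x ℤ.+ 1ℤ → ⊥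
  ≡1∧≡-1⇒⊥ x x≡1 x≡-1 = p∤2 (subst (+ p ∣_) (difference x) (∣m∣n⇒∣m-n x≡-1 x≡1))
    where
    difference : ∀ x → x ℤ.+ 1ℤ - (x - 1ℤ) ≡ + 2
    difference = solve-∀

  -- If (-3)^m ≡ 1 with m odd, then 3^m ≡ -1, so the order 4c of 3 is 2m, contradicting m odd.
  order[3]⇒order[-3]-1mod4 : p % 4 ≡ 1 → Order p (+ 3) (p ∸ 1) → Order p (- + 3) (p ∸ 1)
  order[3]⇒order[-3]-1mod4 p%4≡1 order[3]@(1≤p∸1 , 3^[p∸1]≡1 , minimal[3]) =
    1≤p∸1 , subst (λ x → + p ∣ x - 1ℤ) (sym (-3^≡3^ (p ∸ 1) -1^[p∸1]≡1)) 3^[p∸1]≡1 , minimal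
    where
    c : ℕ
    c = p / 4
    p∸1≡4c : p ∸ 1 ≡ 2 ℕ.* (2 ℕ.* c)
    p∸1≡4c = trans (cong (_∸ 1) (trans (ℕ.m≡m%n+[m/n]*n p 4) (cong (_+ c ℕ.* 4) p%4≡1))) (regroup c)
      where
      regroup : ∀ c → c ℕ.* 4 ≡ 2 ℕ.* (2 ℕ.* c)
      regroup = ℕ-Solver.solve-∀
    -1^[p∸1]≡1 : -1ℤ ^ (p ∸ 1) ≡ 1ℤ
    -1^[p∸1]≡1 = trans (cong (-1ℤ ^_) p∸1≡4c) (-1^-even (2 ℕ.* c))
    minimal : ∀ m → 1 ≤ m → m < p ∸ 1 → ¬ + p ∣ (- + 3) ^ m - 1ℤ
    minimal m 1≤m m<p∸1 -3^m≡1 with -3^≡1⇒ m -3^m≡1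
    ... | inj₁ (_ , 3^m≡1) = minimal[3] m 1≤m m<p∸1 3^m≡1
    ... | inj₂ (-1^m≡-1 , 3^m≡-1) = contradiction (trans (sym -1^m≡-1) -1^m≡1) λ ()
      where
      3^[2m]≡1 : + p ∣ (+ 3) ^ (2 ℕ.* m) - 1ℤ
      3^[2m]≡1 = subst (λ x → + p ∣ x - 1ℤ)
        (trans (ℤ.^-*-assoc (+ 3) m 2) (cong ((+ 3) ^_) (ℕ.*-comm m 2)))
        (∣x-y⇒∣x^n-y^n ((+ 3) ^ m) -1ℤ 2 3^m≡-1)
      2m≡p∸1 : 2 ℕ.* m ≡ p ∸ 1
      2m≡p∸1 = order-unique-below-double order[3] 3^[2m]≡1
        (ℕ.≤-trans 1≤m (ℕ.m≤m+n m (m + 0))) (ℕ.*-monoʳ-< 2 m<p∸1)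
      -1^m≡1 : -1ℤ ^ m ≡ 1ℤ
      -1^m≡1 = trans (cong (-1ℤ ^_) (ℕ.*-cancelˡ-≡ m (2 ℕ.* c) 2 (trans 2m≡p∸1 p∸1≡4c))) (-1^-even c)

  -- Here 3 has odd order h: 3^m ≡ 1 forces m = h, which is odd, while 3^m ≡ -1 would give
  -- (-1)^h ≡ (3^m)^h = (3^h)^m ≡ 1.
  order[3]⇒order[-3]-3mod4 : p % 4 ≡ 3 → Order p (+ 3) ((p ∸ 1) / 2) → Order p (- + 3) (p ∸ 1)
  order[3]⇒order[-3]-3mod4 p%4≡3 order[3]′ =
    subst (1 ≤_) (sym p∸1≡2h) (s≤s z≤n) ,
    subst (λ x → + p ∣ x - 1ℤ) (sym (-3^≡3^ (p ∸ 1) -1^[p∸1]≡1)) 3^[p∸1]≡1 ,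
    minimal
    where
    c : ℕ
    c = p / 4
    h : ℕ
    h = suc (2 ℕ.* c)
    p∸1≡2h : p ∸ 1 ≡ 2 ℕ.* h
    p∸1≡2h = trans (cong (_∸ 1) (trans (ℕ.m≡m%n+[m/n]*n p 4) (cong (_+ c ℕ.* 4) p%4≡3))) (regroup c)
      where
      regroup : ∀ c → 2 + c ℕ.* 4 ≡ 2 ℕ.* suc (2 ℕ.* c)
      regroup = ℕ-Solver.solve-∀
    order[3] : Order p (+ 3) h
    order[3] = subst (Order p (+ 3))
      (trans (cong (_/ 2) (trans p∸1≡2h (ℕ.*-comm 2 h))) (ℕ.m*n/n≡m h 2)) order[3]′
    3^h≡1 : + p ∣ (+ 3) ^ h - 1ℤ
    3^h≡1 = proj₁ (proj₂ order[3])
    -1^h≡-1 : -1ℤ ^ h ≡ -1ℤ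
    -1^h≡-1 = -1^-odd c
    -1^[p∸1]≡1 : -1ℤ ^ (p ∸ 1) ≡ 1ℤ
    -1^[p∸1]≡1 = trans (cong (-1ℤ ^_) p∸1≡2h) (-1^-even h)
    3^[p∸1]≡1 : + p ∣ (+ 3) ^ (p ∸ 1) - 1ℤ
    3^[p∸1]≡1 = subst (λ x → + p ∣ x - 1ℤ)
      (trans (ℤ.^-*-assoc (+ 3) h 2) (cong ((+ 3) ^_) (trans (ℕ.*-comm h 2) (sym p∸1≡2h))))
      (∣x-y⇒∣x^n-y^n ((+ 3) ^ h) 1ℤ 2 3^h≡1)
    minimal : ∀ m → 1 ≤ m → m < p ∸ 1 → ¬ + p ∣ (- + 3) ^ m - 1ℤ
    minimal m 1≤m m<p∸1 -3^m≡1 with -3^≡1⇒ m -3^m≡1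
    ... | inj₁ (-1^m≡1 , 3^m≡1) =
      contradiction (trans (sym -1^h≡-1) (trans (cong (-1ℤ ^_) (sym m≡h)) -1^m≡1)) λ ()
      where
      m≡h : m ≡ h
      m≡h = order-unique-below-double order[3] 3^m≡1 1≤m (subst (m <_) p∸1≡2h m<p∸1)
    ... | inj₂ (_ , 3^m≡-1) = ≡1∧≡-1⇒⊥ ((+ 3) ^ (m ℕ.* h)) 3^[mh]≡1 3^[mh]≡-1
      where
      3^[mh]≡1 : + p ∣ (+ 3) ^ (m ℕ.* h) - 1ℤ
      3^[mh]≡1 = subst (λ x → + p ∣ x - 1ℤ)
        (trans (ℤ.^-*-assoc (+ 3) h m) (cong ((+ 3) ^_) (ℕ.*-comm h m)))
        (subst (λ x → + p ∣ ((+ 3) ^ h) ^ m - x) (ℤ.^-zeroˡ m) (∣x-y⇒∣x^n-y^n ((+ 3) ^ h) 1ℤ m 3^h≡1))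
      3^[mh]≡-1 : + p ∣ (+ 3) ^ (m ℕ.* h) ℤ.+ 1ℤ
      3^[mh]≡-1 = subst (λ x → + p ∣ (+ 3) ^ (m ℕ.* h) - x) -1^h≡-1
        (subst (λ x → + p ∣ x - -1ℤ ^ h) (ℤ.^-*-assoc (+ 3) m h) (∣x-y⇒∣x^n-y^n ((+ 3) ^ m) -1ℤ h 3^m≡-1))

  hypothesis⇒order[-3] : (p % 4 ≡ 1 × MultOrder p 3 (p ∸ 1)) ⊎ (p % 4 ≡ 3 × MultOrder p 3 ((p ∸ 1) / 2)) →
                         Order p (- + 3) (p ∸ 1)
  hypothesis⇒order[-3] (inj₁ (p%4≡1 , order[3])) = order[3]⇒order[-3]-1mod4 p%4≡1 (multOrder⇒order order[3])
  hypothesis⇒order[-3] (inj₂ (p%4≡3 , order[3])) = order[3]⇒order[-3]-3mod4 p%4≡3 (multOrder⇒order order[3])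

  ∣[Δu]*4⇒≡ : ∀ n k → + p ∣ (u (n + k) - u n) * + 4 → u n ≡[ p ] u (n + k)
  ∣[Δu]*4⇒≡ n k p∣Δ*4 = ∣⇒∣ᵤ (∣m-n⇒∣n-m (u (n + k)) (u n) p∣Δ)
    where
    p∣Δ : + p ∣ u (n + k) - u n
    p∣Δ = ∣*-cancelˡ p-prime p∤4 (subst (+ p ∣_) (ℤ.*-comm (u (n + k) - u n) (+ 4)) p∣Δ*4)

  -3^k≡-5⇒u[k]≡u[k+1] : ∀ k → + p ∣ (- + 3) ^ k ℤ.+ + 5 → u k ≡[ p ] u (k + 1)
  -3^k≡-5⇒u[k]≡u[k+1] k p∣-3^k+5 =
    ∣[Δu]*4⇒≡ k 1 (subst (+ p ∣_) (sym (u-step k)) (∣n⇒∣m*n (+ 2 * -1ℤ ^ k) p∣-3^k+5))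

  module _ (order[-3] : Order p (- + 3) (p ∸ 1)) where

    p≢7 : p ≢ 7
    p≢7 refl = ¬order[7,-3,6] order[-3]

    p∤7 : ¬ + p ∣ + 7
    p∤7 p∣7 with prime⇒irreducible (from-yes (prime? 7)) (∣⇒∣ᵤ p∣7)
    ... | inj₁ p≡1 = ℕ.<⇒≢ (ℕ.<-trans (s≤s (s≤s z≤n)) 5<p) (sym p≡1)
    ... | inj₂ p≡7 = p≢7 p≡7

    last-exponent-no-solution : ∀ k → suc k ≡ p ∸ 1 → ¬ + p ∣ (- + 3) ^ k ℤ.+ + 5
    last-exponent-no-solution k k+1≡p∸1 p∣-3^k+5 = ∤*∤ p-prime p∤2 p∤7
      (subst (+ p ∣_) (difference ((- + 3) ^ k)) (∣m∣n⇒∣m-n -3^[k+1]≡1 (∣n⇒∣m*n (- + 3) p∣-3^k+5)))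
      where
      difference : ∀ X → (- + 3 * X - 1ℤ) - (- + 3) * (X ℤ.+ + 5) ≡ + 2 * + 7
      difference = solve-∀
      -3^[k+1]≡1 : + p ∣ (- + 3) ^ suc k - 1ℤ
      -3^[k+1]≡1 = subst (λ e → + p ∣ (- + 3) ^ e - 1ℤ) (sym k+1≡p∸1) (proj₁ (proj₂ order[-3]))

    consecutive-congruence : ∃[ k ] 1 ≤ k × k ≤ p ∸ 3 × u k ≡[ p ] u (k + 1)
    consecutive-congruence
      with order⇒^-surjective {x = - + 5} p-prime order[-3] (p∤3 ∘ ∣m⇒∣-m) (p∤5 ∘ ∣m⇒∣-m)
    ... | zero  , _       , p∣6      = contradiction p∣6 (∤*∤ p-prime p∤2 p∤3)
    ... | suc k , k<p∸1 , solution =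
      suc k , s≤s z≤n , k≤p∸3 , -3^k≡-5⇒u[k]≡u[k+1] (suc k) solution
      where
      k≤p∸3 : suc k ≤ p ∸ 3
      k≤p∸3 = subst (suc k ≤_) (ℕ.∸-+-assoc p 1 2)
        (ℕ.∸-monoˡ-≤ 2 (ℕ.≤∧≢⇒< k<p∸1 λ k+2≡p∸1 →
          last-exponent-no-solution (suc k) k+2≡p∸1 solution))

    -1^[p∸1]≡1 : -1ℤ ^ (p ∸ 1) ≡ 1ℤ
    -1^[p∸1]≡1 = trans (cong (-1ℤ ^_) (prime>2⇒p∸1≡2*[p/2] p-prime 2<p)) (-1^-even (p / 2))
      where
      2<p : 2 < p
      2<p = ℕ.<-trans (s≤s (s≤s (s≤s z≤n))) 5<p

    isPeriod : IsPeriod p (p ∸ 1)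
    isPeriod n _ = ∣[Δu]*4⇒≡ n (p ∸ 1) (subst (+ p ∣_) (sym (u-shift n (p ∸ 1)))
      (∣m∣n⇒∣m-n (∣n⇒∣m*n ((+ 3) ^ n) 3^[p∸1]≡1) (∣n⇒∣m*n (+ 5 * -1ℤ ^ n) p∣-1^[p∸1]-1)))
      where
      3^[p∸1]≡1 : + p ∣ (+ 3) ^ (p ∸ 1) - 1ℤ
      3^[p∸1]≡1 = subst (λ x → + p ∣ x - 1ℤ) (-3^≡3^ (p ∸ 1) -1^[p∸1]≡1) (proj₁ (proj₂ order[-3]))
      p∣-1^[p∸1]-1 : + p ∣ -1ℤ ^ (p ∸ 1) - 1ℤ
      p∣-1^[p∸1]-1 = subst (λ s → + p ∣ s - 1ℤ) (sym -1^[p∸1]≡1) (divides 0ℤ refl)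

    not-period : ∀ m → 1 ≤ m → m < p ∸ 1 → ¬ IsPeriod p m
    not-period m 1≤m m<p∸1 period = proj₂ (proj₂ order[-3]) m 1≤m m<p∸1 -3^m≡1
      where
      A B : ℤ
      A = (+ 3) ^ m - 1ℤ
      B = -1ℤ ^ m - 1ℤ
      shift : ∀ n → 1 ≤ n → + p ∣ (+ 3) ^ n * A - + 5 * -1ℤ ^ n * B
      shift n 1≤n = subst (+ p ∣_) (u-shift n m) (≡⇒∣[Δu]*4 n m (period n 1≤n))
      twelve : ∀ A B → (+ 3 * A - + 5 * -1ℤ * B) ℤ.+ (+ 9 * A - + 5 * 1ℤ * B) ≡ + 3 * + 4 * A
      twelve = solve-∀
      five : ∀ A B → (+ 3 * A - + 5 * -1ℤ * B) - + 3 * A ≡ + 5 * B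
      five = solve-∀
      p∣A : + p ∣ A
      p∣A = ∣*-cancelˡ p-prime (∤*∤ p-prime p∤3 p∤4)
        (subst (+ p ∣_) (twelve A B) (∣m∣n⇒∣m+n (shift 1 (s≤s z≤n)) (shift 2 (s≤s z≤n))))
      p∣B : + p ∣ B
      p∣B = ∣*-cancelˡ p-prime p∤5
        (subst (+ p ∣_) (five A B) (∣m∣n⇒∣m-n (shift 1 (s≤s z≤n)) (∣n⇒∣m*n (+ 3) p∣A)))
      -1^m≡1 : -1ℤ ^ m ≡ 1ℤ
      -1^m≡1 with -1^-cases m
      ... | inj₁ -1^m≡1  = -1^m≡1
      ... | inj₂ -1^m≡-1 = contradiction (∣m⇒∣-m (subst (λ s → + p ∣ s - 1ℤ) -1^m≡-1 p∣B)) p∤2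
      -3^m≡1 : + p ∣ (- + 3) ^ m - 1ℤ
      -3^m≡1 = subst (λ x → + p ∣ x - 1ℤ) (sym (-3^≡3^ m -1^m≡1)) p∣A

    ρ≡p∸1 : Rho p (p ∸ 1)
    ρ≡p∸1 = proj₁ order[-3] , isPeriod , not-period

    ι<p∸1 : ∀ i → Iota p i → i < p ∸ 1
    ι<p∸1 i ι with consecutive-congruence
    ... | k , 1≤k , k≤p∸3 , u[k]≡u[k+1] =
      ℕ.≤-<-trans (ι≤ 1≤k u[k]≡u[k+1] ι) (ℕ.≤-<-trans k≤p∸3 (ℕ.∸-monoʳ-< (s≤s (s≤s z≤n)) 3≤p))
      where
      3≤p : 3 ≤ p
      3≤p = ℕ.≤-trans (s≤s (s≤s (s≤s z≤n))) (ℕ.<⇒≤ 5<p)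

lemma20 : (p : ℕ) → Prime p → 5 < p →
          ((p % 4 ≡ 1 × MultOrder p 3 (p ∸ 1)) ⊎ (p % 4 ≡ 3 × MultOrder p 3 ((p ∸ 1) / 2))) →
          Σ ℕ (λ k → 1 ≤ k × k ≤ p ∸ 3 × u k ≡[ p ] u (k + 1))
          × Rho p (p ∸ 1)
          × (∀ i → Iota p i → i < p ∸ 1)
lemma20 p p-prime 5<p hypothesis =
  consecutive-congruence p-prime 5<p order[-3] ,
  ρ≡p∸1 p-prime 5<p order[-3] ,
  ι<p∸1 p-prime 5<p order[-3]
  where
  order[-3] : Order p (- + 3) (p ∸ 1)
  order[-3] = hypothesis⇒order[-3] p-prime 5<p hypothesis
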